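{- For every integer $k\geq 2$, there are infinitely many (pairwise non-isomorphic) minimally strongly $k$-connected tournaments.
   Context: A tournament is a digraph in which every pair of distinct vertices is joined by exactly one directed edge. A digraph $D$ is strongly $k$-connected if $|V(D)|\geq k+1$ and for every ordered pair $(u,v)$ of vertices and every $S\subseteq V(D)\setminus\{u,v\}$ with $|S|\leq k-1$, there is a directed path from $u$ to $v$ in $D-S$. A tournament is minimally strongly $k$-connected if it is strongly $k$-connected but none of its proper (induced) subtournaments is strongly $k$-connected. -}

module Defs where

open import Data.Nat using (ℕ; _≤_; _<_; _+_; _∸_)
open import Data.Fin using (Fin)
open import Data.Fin.Subset using (Subset; _∉_; ∣_∣)
open import Data.Bool using (Bool; true; false)
open import Data.Product using (Σ; ∃; _×_; _,_)
open import Data.Sum using (_⊎_)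
open import Relation.Binary.PropositionalEquality using (_≡_; _≢_; refl)
open import Relation.Nullary using (¬_)
open import Function.Bundles using (_↔_; Inverse)
open import Function.Definitions using (Injective)

record Tournament : Set where
  field
    n      : ℕ
    arc    : Fin n → Fin n → Bool
    irrefl : ∀ u → arc u u ≡ false
    total  : ∀ u v → u ≢ v →
             (arc u v ≡ true × arc v u ≡ false) ⊎ (arc u v ≡ false × arc v u ≡ true)

open Tournament public

-- Directed walk from u to v in T - S (all vertices after u avoid S; u itself
-- is required to avoid S in the definition of connectivity below).
-- A walk exists iff a path exists, so this captures "there is a directed path".
data Reach (T : Tournament) (S : Subset (n T)) : Fin (n T) → Fin (n T) → Set where
  here : ∀ {u} → Reach T S u u
  step : ∀ {u w v} → arc T u w ≡ true → w ∉ S → Reach T S w v → Reach T S u v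

StronglyConnected : ℕ → Tournament → Set
StronglyConnected k T =
  (k + 1 ≤ n T) ×
  (∀ (u v : Fin (n T)) (S : Subset (n T)) → u ∉ S → v ∉ S → ∣ S ∣ ≤ k ∸ 1 → Reach T S u v)

induced : (T : Tournament) {m : ℕ} (f : Fin m → Fin (n T)) → Injective _≡_ _≡_ f → Tournament
induced T {m} f inj = record
  { n = m
  ; arc = λ i j → arc T (f i) (f j)
  ; irrefl = λ i → irrefl T (f i)
  ; total = λ i j i≢j → total T (f i) (f j) (λ e → i≢j (inj e))
  }

MinimallyStronglyConnected : ℕ → Tournament → Set
MinimallyStronglyConnected k T =
  StronglyConnected k T ×
  (∀ {m} (f : Fin m → Fin (n T)) (inj : Injective _≡_ _≡_ f) → m < n T →
     ¬ StronglyConnected k (induced T f inj))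

Isomorphic : Tournament → Tournament → Set
Isomorphic T U =
  Σ (Fin (n T) ↔ Fin (n U)) λ φ →
    ∀ u v → arc U (Inverse.to φ u) (Inverse.to φ v) ≡ arc T u v

module Submission where

-- Let Tₜ have vertices 0, …, N−1 with N = 4k + t, all arcs pointing from the larger to the
-- smaller vertex except the arcs i → i+k and the arcs of length at least k inside the lower
-- block [0, 2k) and inside the upper block [N−2k, N).
-- Deleting at most k−1 vertices leaves some residue class mod k untouched; its least element r
-- is a hub: the chain r → r+k → r+2k → … together with short backward arcs lets every vertex
-- reach r and r reach every vertex. So Tₜ is strongly k-connected.
-- Conversely, a strongly k-connected subtournament has all in- and out-degrees at least k. This
-- forces its least vertex to be 0 and its greatest to be N−1, whose out- resp. in-neighbourhoods
-- have exactly k elements and hence bring in both blocks; and a missing middle vertex c+k would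
-- let the k−1 vertices strictly between c and c+k separate 0 from N−1. So the subtournament is
-- all of Tₜ, and the Tₜ are pairwise non-isomorphic because their sizes differ.

open import Defs
open import Data.Nat using (ℕ; zero; suc; _+_; _*_; _∸_; _≤_; _<_; z≤n; s≤s; z<s; _≟_; _≤?_; _<?_)
open import Data.Nat.DivMod using (_%_; _/_; m≡m%n+[m/n]*n; [m+n]%n≡m%n; [m+kn]%n≡m%n; m<n⇒m%n≡m)
open import Data.Nat.Properties
open import Data.Fin using (Fin; toℕ; fromℕ<; punchIn; punchOut) renaming (zero to fzero; suc to fsuc)
open import Data.Fin.Properties using (any?; injective⇒≤; toℕ-injective; toℕ-fromℕ<; toℕ<n; punchIn-punchOut) renaming (_≟_ to _≟ᶠ_; suc-injective to fsuc-injective)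
open import Data.Fin.Subset using (Subset; _∈_; _∉_; _⊆_; ∣_∣; ⁅_⁆; ∁; inside; outside)
open import Data.Fin.Subset.Properties using (_∈?_; x∈⁅x⁆; x∈∁p⇒x∉p; p⊆q⇒∣p∣≤∣q∣; ∣⁅x⁆∣≡1; ∣∁p∣≡n∸∣p∣)
open import Data.Bool using (Bool; true; false)
open import Data.Product using (Σ; ∃; _×_; _,_; proj₁; proj₂)
open import Data.Sum using (_⊎_; inj₁; inj₂)
open import Data.Vec using ([]; _∷_; here; there; tabulate)
open import Data.Vec.Functional using () renaming (_∷_ to _∷ᶠ_)
open import Data.Vec.Properties using ([]=⇒lookup; lookup⇒[]=; lookup∘tabulate)
open import Data.Empty using (⊥-elim)
open import Function using (_∘_)
open import Function.Definitions using (Injective)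
open import Data.Fin.Permutation using (↔⇒≡)
open import Relation.Nullary using (¬_; Dec; yes; no; does; contradiction; ¬?)
open import Relation.Nullary.Decidable using (_×-dec_; _⊎-dec_; dec-true; dec-false)
open import Relation.Unary using (Decidable)
open import Relation.Binary using (tri<; tri≈; tri>)
open import Relation.Binary.PropositionalEquality

private variable
  j m : ℕ

enumerate : (p : Subset m) →
            Σ (Fin ∣ p ∣ → Fin m) λ e →
              Injective _≡_ _≡_ e × (∀ i → e i ∈ p) × (∀ x → x ∈ p → ∃ λ i → e i ≡ x)
enumerate [] = (λ ()) , (λ {}) , (λ ()) , (λ _ ())
enumerate (outside ∷ p) with enumerate p
... | e , e-inj , e∈p , e-onto = fsuc ∘ e , e-inj ∘ fsuc-injective , there ∘ e∈p , onto
  where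
  onto : ∀ x → x ∈ outside ∷ p → ∃ λ i → fsuc (e i) ≡ x
  onto (fsuc x) (there x∈p) with e-onto x x∈p
  ... | i , refl = i , refl
enumerate (inside ∷ p) with enumerate p
... | e , e-inj , e∈p , e-onto = e′ , inj , e′∈ , onto
  where
  e′ : Fin (suc ∣ p ∣) → Fin _
  e′ fzero    = fzero
  e′ (fsuc i) = fsuc (e i)
  inj : Injective _≡_ _≡_ e′
  inj {fzero}  {fzero}  _  = refl
  inj {fsuc i} {fsuc j} eq = cong fsuc (e-inj (fsuc-injective eq))
  e′∈ : ∀ i → e′ i ∈ inside ∷ p
  e′∈ fzero    = here
  e′∈ (fsuc i) = there (e∈p i)
  onto : ∀ x → x ∈ inside ∷ p → ∃ λ i → e′ i ≡ x
  onto fzero    _           = fzero , refl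
  onto (fsuc x) (there x∈p) with e-onto x x∈p
  ... | i , refl = fsuc i , refl

injection-into⇒≤∣p∣ : (p : Subset m) (h : Fin j → Fin m) → Injective _≡_ _≡_ h → (∀ l → h l ∈ p) →
                      j ≤ ∣ p ∣
injection-into⇒≤∣p∣ p h h-inj h∈p with enumerate p
... | e , _ , _ , e-onto = injective⇒≤ rank-inj
  where
  rank : _ → Fin ∣ p ∣
  rank l = proj₁ (e-onto (h l) (h∈p l))
  rank-inj : Injective _≡_ _≡_ rank
  rank-inj {a} {b} eq = h-inj (begin
    h a              ≡⟨ proj₂ (e-onto (h a) (h∈p a)) ⟨
    e (rank a)       ≡⟨ cong e eq ⟩
    e (rank b)       ≡⟨ proj₂ (e-onto (h b) (h∈p b)) ⟩
    h b              ∎)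
    where open ≡-Reasoning

injection-from⇒∣p∣≤ : (p : Subset m) (c : ∀ x → x ∈ p → Fin j) →
                      (∀ {x y} x∈p y∈p → c x x∈p ≡ c y y∈p → x ≡ y) → ∣ p ∣ ≤ j
injection-from⇒∣p∣≤ p c c-inj with enumerate p
... | e , e-inj , e∈p , _ = injective⇒≤ (λ eq → e-inj (c-inj (e∈p _) (e∈p _) eq))

∃-outside-except : (p : Subset m) → 2 + ∣ p ∣ ≤ m → (v : Fin m) → ∃ λ u → u ≢ v × u ∉ p
∃-outside-except {m} p size v with any? (λ u → ¬? (u ≟ᶠ v) ×-dec ¬? (u ∈? p))
... | yes w = w
... | no ∄ = ⊥-elim (<⇒≱ (m+n≤o⇒m≤o∸n 2 size) (begin
      m ∸ ∣ p ∣   ≡⟨ ∣∁p∣≡n∸∣p∣ p ⟨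
      ∣ ∁ p ∣     ≤⟨ p⊆q⇒∣p∣≤∣q∣ ∁p⊆⁅v⁆ ⟩
      ∣ ⁅ v ⁆ ∣   ≡⟨ ∣⁅x⁆∣≡1 v ⟩
      1           ∎))
  where
  open ≤-Reasoning
  ∁p⊆⁅v⁆ : ∁ p ⊆ ⁅ v ⁆
  ∁p⊆⁅v⁆ {x} x∈∁p with x ≟ᶠ v
  ... | yes refl = x∈⁅x⁆ x
  ... | no x≢v   = ⊥-elim (∄ (x , x≢v , x∈∁p⇒x∉p x∈∁p))

does≡true⇒ : {A : Set} (a? : Dec A) → does a? ≡ true → A
does≡true⇒ (yes a) _ = a

select : {P : Fin m → Set} → Decidable P → Subset m
select P? = tabulate (does ∘ P?)

∈-select⁻ : {P : Fin m → Set} (P? : Decidable P) {x : Fin m} → x ∈ select P? → P x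
∈-select⁻ P? {x} x∈ = does≡true⇒ (P? x) (trans (sym (lookup∘tabulate (does ∘ P?) x)) ([]=⇒lookup x∈))

∈-select⁺ : {P : Fin m → Set} (P? : Decidable P) {x : Fin m} → P x → x ∈ select P?
∈-select⁺ P? {x} px = lookup⇒[]= x _ (trans (lookup∘tabulate (does ∘ P?) x) (dec-true (P? x) px))

Closed : (T : Tournament) → Subset (n T) → (Fin (n T) → Set) → Set
Closed T S P = ∀ {x y} → x ∉ S → P x → arc T x y ≡ true → y ∉ S → P y

module _ {T : Tournament} {S : Subset (n T)} where

  reach-trans : ∀ {u w v} → Reach T S u w → Reach T S w v → Reach T S u v
  reach-trans here           q = q
  reach-trans (step a w∉S p) q = step a w∉S (reach-trans p q)

  reach-preserves-closed : {P : Fin (n T) → Set} → Closed T S P →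
                           ∀ {u v} → Reach T S u v → u ∉ S → P u → P v
  reach-preserves-closed closed here           _   pu = pu
  reach-preserves-closed closed (step a w∉S p) u∉S pu = reach-preserves-closed closed p w∉S (closed u∉S pu a w∉S)

module _ {k : ℕ} {T : Tournament} (conn : StronglyConnected k T) {S : Subset (n T)} (small : ∣ S ∣ ≤ k ∸ 1) where

  closed-propagates : {P : Fin (n T) → Set} → Closed T S P → ∀ {u v} → u ∉ S → v ∉ S → P u → P v
  closed-propagates closed {u} {v} u∉S v∉S = reach-preserves-closed closed (proj₂ conn u v S u∉S v∉S small) u∉S

module _ {k : ℕ} {T : Tournament} (conn : StronglyConnected (suc k) T) {S : Subset (n T)} (small : ∣ S ∣ ≤ k) where

  private
    other : ∀ v → ∃ λ u → u ≢ v × u ∉ S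
    other = ∃-outside-except S (≤-trans (+-monoʳ-≤ 2 small) (subst (_≤ n T) (+-comm (suc k) 1) (proj₁ conn)))

  min-out-degree : ∀ {v} → v ∉ S → ¬ (∀ y → arc T v y ≡ true → y ∈ S)
  min-out-degree {v} v∉S out⊆S with other v
  ... | u , u≢v , u∉S = u≢v (closed-propagates {suc k} conn small closed v∉S u∉S refl)
    where
    closed : Closed T S (_≡ v)
    closed _ refl a y∉S = contradiction (out⊆S _ a) y∉S

  min-in-degree : ∀ {v} → v ∉ S → ¬ (∀ x → arc T x v ≡ true → x ∈ S)
  min-in-degree {v} v∉S in⊆S with other v
  ... | u , u≢v , u∉S = closed-propagates {suc k} conn small closed u∉S v∉S u≢v refl
    where
    closed : Closed T S (_≢ v)
    closed x∉S _ a _ refl = contradiction (in⊆S _ a) x∉S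

InImage : (Fin j → ℕ) → ℕ → Set
InImage g z = ∃ λ l → g l ≡ z

inImage? : (g : Fin j → ℕ) → ∀ z → Dec (InImage g z)
inImage? g z = any? (λ l → g l ≟ z)

InImage-punchIn : {g : Fin (suc j) → ℕ} {z : ℕ} (l₀ : Fin (suc j)) → InImage g z → g l₀ ≢ z →
                  InImage (g ∘ punchIn l₀) z
InImage-punchIn {g = g} l₀ (l , refl) gl₀≢gl with l₀ ≟ᶠ l
... | yes refl = contradiction refl gl₀≢gl
... | no l₀≢l  = punchOut l₀≢l , cong g (punchIn-punchOut l₀≢l)

interval : ℕ → (len : ℕ) → Fin len → ℕ
interval lo _ l = lo + toℕ l

∈-interval : ∀ {lo len z} → lo ≤ z → z < lo + len → InImage (interval lo len) z
∈-interval {lo} {len} {z} lo≤z z<lo+len = fromℕ< offset<len , (begin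
    lo + toℕ (fromℕ< offset<len)  ≡⟨ cong (lo +_) (toℕ-fromℕ< offset<len) ⟩
    lo + (z ∸ lo)                 ≡⟨ m+[n∸m]≡n lo≤z ⟩
    z                             ∎)
  where
  open ≡-Reasoning
  offset<len : z ∸ lo < len
  offset<len = +-cancelˡ-< lo _ _ (subst (_< lo + len) (sym (m+[n∸m]≡n lo≤z)) z<lo+len)

interval-bounds : ∀ {lo len z} → InImage (interval lo len) z → lo ≤ z × z < lo + len
interval-bounds {lo} (l , refl) = m≤m+n lo (toℕ l) , +-monoʳ-< lo (toℕ<n l)

∉-interval : ∀ {lo len z} → z < lo ⊎ lo + len ≤ z → ¬ InImage (interval lo len) z
∉-interval (inj₁ z<lo)      z∈ = <⇒≱ z<lo (proj₁ (interval-bounds z∈))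
∉-interval (inj₂ lo+len≤z) z∈ = <⇒≱ (proj₂ (interval-bounds z∈)) lo+len≤z

∈-∷-head : ∀ {e} {g : Fin j → ℕ} → InImage (e ∷ᶠ g) e
∈-∷-head = fzero , refl

∈-∷-tail : ∀ {e z} {g : Fin j → ℕ} → InImage g z → InImage (e ∷ᶠ g) z
∈-∷-tail (l , gl≡z) = fsuc l , gl≡z

∉-∷ : ∀ {e z} {g : Fin j → ℕ} → z ≢ e → ¬ InImage g z → ¬ InImage (e ∷ᶠ g) z
∉-∷ z≢e _    (fzero  , e≡z)  = z≢e (sym e≡z)
∉-∷ _   z∉g  (fsuc l , gl≡z) = z∉g (l , gl≡z)

lowest : {P : ℕ → Set} → Decidable P → ∀ {x} → P x → ∃ λ a → P a × (∀ z → z < a → ¬ P z)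
lowest P? {zero} p0 = zero , p0 , λ _ ()
lowest P? {suc x} px with P? zero
... | yes p0 = zero , p0 , λ _ ()
... | no ¬p0 with lowest (P? ∘ suc) px
...   | a , pa , below = suc a , pa , λ where
          zero    _         → ¬p0
          (suc z) (s≤s z<a) → below z z<a

highest : {P : ℕ → Set} → Decidable P → ∀ b → (∀ {z} → P z → z ≤ b) → ∀ {x} → P x →
          ∃ λ a → P a × (∀ z → a < z → ¬ P z)
highest P? b bounded px with P? b
... | yes pb = b , pb , λ z b<z pz → <⇒≱ b<z (bounded pz)
highest {P} P? zero bounded px | no ¬pb = contradiction (subst P (n≤0⇒n≡0 (bounded px)) px) ¬pb
highest P? (suc b) bounded px | no ¬pb = highest P? b bounded′ px
  where
  bounded′ : ∀ {z} → _ → z ≤ b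
  bounded′ {z} pz with m≤n⇒m<n∨m≡n (bounded pz)
  ... | inj₁ z<1+b = <⇒≤pred z<1+b
  ... | inj₂ refl  = contradiction pz ¬pb

-- A family g : Fin j → ℕ of labels stands for the at most j vertices x with F x in its image.
module Labelling {T : Tournament} {F : Fin (n T) → ℕ} (F-inj : Injective _≡_ _≡_ F) where

  labelled : (Fin j → ℕ) → Subset (n T)
  labelled g = select (λ x → inImage? g (F x))

  ∈-labelled⁺ : (g : Fin j → ℕ) {x : Fin (n T)} → InImage g (F x) → x ∈ labelled g
  ∈-labelled⁺ g = ∈-select⁺ (λ x → inImage? g (F x))

  ∈-labelled⁻ : (g : Fin j → ℕ) {x : Fin (n T)} → x ∈ labelled g → InImage g (F x)
  ∈-labelled⁻ g = ∈-select⁻ (λ x → inImage? g (F x))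

  ∉-labelled⁺ : (g : Fin j → ℕ) {x : Fin (n T)} → ¬ InImage g (F x) → x ∉ labelled g
  ∉-labelled⁺ g x∉ = x∉ ∘ ∈-labelled⁻ g

  ∣labelled∣≤ : (g : Fin j → ℕ) → ∣ labelled g ∣ ≤ j
  ∣labelled∣≤ g = injection-from⇒∣p∣≤ _ (λ _ x∈ → proj₁ (∈-labelled⁻ g x∈)) label-inj
    where
    label-inj : ∀ {x y} (x∈ : x ∈ labelled g) (y∈ : y ∈ labelled g) →
                proj₁ (∈-labelled⁻ g x∈) ≡ proj₁ (∈-labelled⁻ g y∈) → x ≡ y
    label-inj x∈ y∈ eq = F-inj (begin
      F _                          ≡⟨ proj₂ (∈-labelled⁻ g x∈) ⟨
      g (proj₁ (∈-labelled⁻ g x∈))   ≡⟨ cong g eq ⟩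
      g (proj₁ (∈-labelled⁻ g y∈))   ≡⟨ proj₂ (∈-labelled⁻ g y∈) ⟩
      F _                          ∎)
      where open ≡-Reasoning

  module _ {k : ℕ} (conn : StronglyConnected (suc k) T) where

    out-labels-large : (g : Fin j → ℕ) → j ≤ k → ∀ {v} → ¬ InImage g (F v) →
                       ¬ (∀ y → arc T v y ≡ true → InImage g (F y))
    out-labels-large g j≤k v∉ cov =
      min-out-degree conn (≤-trans (∣labelled∣≤ g) j≤k) (∉-labelled⁺ g v∉) (λ y a → ∈-labelled⁺ g (cov y a))

    in-labels-large : (g : Fin j → ℕ) → j ≤ k → ∀ {v} → ¬ InImage g (F v) →
                      ¬ (∀ x → arc T x v ≡ true → InImage g (F x))
    in-labels-large g j≤k v∉ cov =
      min-in-degree conn (≤-trans (∣labelled∣≤ g) j≤k) (∉-labelled⁺ g v∉) (λ x a → ∈-labelled⁺ g (cov x a))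

    out-labels-realised : (g : Fin (suc k) → ℕ) → ∀ {v} → ¬ InImage g (F v) →
                          (∀ y → arc T v y ≡ true → InImage g (F y)) → ∀ l → InImage F (g l)
    out-labels-realised g v∉ cov l₀ with inImage? F (g l₀)
    ... | yes realised   = realised
    ... | no unrealised = ⊥-elim (out-labels-large (g ∘ punchIn l₀) ≤-refl
                            (λ (l , e) → v∉ (punchIn l₀ l , e))
                            (λ y a → InImage-punchIn l₀ (cov y a) (λ e → unrealised (y , sym e))))

    in-labels-realised : (g : Fin (suc k) → ℕ) → ∀ {v} → ¬ InImage g (F v) →
                         (∀ x → arc T x v ≡ true → InImage g (F x)) → ∀ l → InImage F (g l)
    in-labels-realised g v∉ cov l₀ with inImage? F (g l₀)
    ... | yes realised   = realised
    ... | no unrealised = ⊥-elim (in-labels-large (g ∘ punchIn l₀) ≤-refl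
                            (λ (l , e) → v∉ (punchIn l₀ l , e))
                            (λ x a → InImage-punchIn l₀ (cov x a) (λ e → unrealised (x , sym e))))

module Construction (k-2 t : ℕ) where

  -- hi is the least vertex of the upper block.
  k-1 k 2k hi N hi-1 N-1 top-k : ℕ
  k-1   = suc k-2
  k     = suc k-1
  2k    = k + k
  hi    = 2k + t
  N     = hi + 2k
  hi-1  = k-1 + k + t
  N-1   = hi + (k-1 + k)
  top-k = hi + k-1

  N≡1+N-1 : N ≡ suc N-1
  N≡1+N-1 = +-suc hi (k-1 + k)

  top-k+k≡N-1 : top-k + k ≡ N-1
  top-k+k≡N-1 = +-assoc hi k-1 k

  hi-1+k≡top-k : hi-1 + k ≡ top-k
  hi-1+k≡top-k = +-suc hi-1 k-1

  Forward : ℕ → ℕ → Set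
  Forward i j = j ≡ i + k ⊎ (i + k ≤ j × (j < 2k ⊎ hi ≤ i))

  forward? : ∀ i j → Dec (Forward i j)
  forward? i j = j ≟ i + k ⊎-dec (i + k ≤? j ×-dec (j <? 2k ⊎-dec hi ≤? i))

  Arc : ℕ → ℕ → Set
  Arc i j = (i < j × Forward i j) ⊎ (j < i × ¬ Forward j i)

  arc? : ∀ i j → Dec (Arc i j)
  arc? i j = (i <? j ×-dec forward? i j) ⊎-dec (j <? i ×-dec ¬? (forward? j i))

  Arc-asym : ∀ {i j} → Arc i j → ¬ Arc j i
  Arc-asym (inj₁ (i<j , _)) (inj₁ (j<i , _)) = <-asym i<j j<i
  Arc-asym (inj₁ (_ , f))   (inj₂ (_ , ¬f))  = ¬f f
  Arc-asym (inj₂ (_ , ¬f))  (inj₁ (_ , f))   = ¬f f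
  Arc-asym (inj₂ (j<i , _)) (inj₂ (i<j , _)) = <-asym i<j j<i

  Arc-connex : ∀ {i j} → i ≢ j → Arc i j ⊎ Arc j i
  Arc-connex {i} {j} i≢j with <-cmp i j | forward? i j | forward? j i
  ... | tri< i<j _ _ | yes f | _     = inj₁ (inj₁ (i<j , f))
  ... | tri< i<j _ _ | no ¬f | _     = inj₂ (inj₂ (i<j , ¬f))
  ... | tri≈ _ i≡j _ | _     | _     = contradiction i≡j i≢j
  ... | tri> _ _ j<i | _     | yes f = inj₂ (inj₁ (j<i , f))
  ... | tri> _ _ j<i | _     | no ¬f = inj₁ (inj₂ (j<i , ¬f))

  arcℕ : ℕ → ℕ → Bool
  arcℕ i j = does (arc? i j)

  Arc⁻ : ∀ {i j} → arcℕ i j ≡ true → Arc i j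
  Arc⁻ {i} {j} = does≡true⇒ (arc? i j)

  arcℕ-total : ∀ {i j} → i ≢ j →
               (arcℕ i j ≡ true × arcℕ j i ≡ false) ⊎ (arcℕ i j ≡ false × arcℕ j i ≡ true)
  arcℕ-total {i} {j} i≢j with Arc-connex i≢j
  ... | inj₁ a = inj₁ (dec-true (arc? i j) a , dec-false (arc? j i) (Arc-asym a))
  ... | inj₂ a = inj₂ (dec-false (arc? i j) (Arc-asym a) , dec-true (arc? j i) a)

  Tₜ : Tournament
  Tₜ = record
    { n      = N
    ; arc    = λ u v → arcℕ (toℕ u) (toℕ v)
    ; irrefl = λ u → dec-false (arc? (toℕ u) (toℕ u)) (λ a → Arc-asym a a)
    ; total  = λ u v u≢v → arcℕ-total (u≢v ∘ toℕ-injective)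
    }

  k≤2k : k ≤ 2k
  k≤2k = m≤m+n k k

  2k≤hi : 2k ≤ hi
  2k≤hi = m≤m+n 2k t

  hi<N : hi < N
  hi<N = m<m+n hi z<s

  2k<N : 2k < N
  2k<N = ≤-<-trans 2k≤hi hi<N

  Forward⇒+k≤ : ∀ {i j} → Forward i j → i + k ≤ j
  Forward⇒+k≤ (inj₁ refl)     = ≤-refl
  Forward⇒+k≤ (inj₂ (le , _)) = le

  short-backward : ∀ {i j} → j < i → i < j + k → Arc i j
  short-backward j<i i<j+k = inj₂ (j<i , λ f → <⇒≱ i<j+k (Forward⇒+k≤ f))

  free-residue : (S : Subset N) → ∣ S ∣ ≤ k-1 → ∃ λ r → r < k × (∀ v → toℕ v % k ≡ r → v ∉ S)
  free-residue S small with any? (λ (r : Fin k) → ¬? (any? (λ v → (toℕ v % k ≟ toℕ r) ×-dec (v ∈? S))))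
  ... | yes (r , unoccupied) = toℕ r , toℕ<n r , λ v v≡r v∈S → unoccupied (v , v≡r , v∈S)
  ... | no ∄unoccupied = ⊥-elim (1+n≰n (≤-trans (injection-into⇒≤∣p∣ S occupant occupant-inj occupant∈S) small))
    where
    occupied : ∀ r → ∃ λ v → toℕ v % k ≡ toℕ r × v ∈ S
    occupied r with any? (λ v → (toℕ v % k ≟ toℕ r) ×-dec (v ∈? S))
    ... | yes occ  = occ
    ... | no ¬occ = ⊥-elim (∄unoccupied (r , ¬occ))
    occupant : Fin k → Fin N
    occupant r = proj₁ (occupied r)
    occupant∈S : ∀ r → occupant r ∈ S
    occupant∈S r = proj₂ (proj₂ (occupied r))
    occupant-inj : Injective _≡_ _≡_ occupant
    occupant-inj {r} {s} eq = toℕ-injective (begin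
      toℕ r                   ≡⟨ proj₁ (proj₂ (occupied r)) ⟨
      toℕ (occupant r) % k    ≡⟨ cong (λ v → toℕ v % k) eq ⟩
      toℕ (occupant s) % k    ≡⟨ proj₁ (proj₂ (occupied s)) ⟩
      toℕ s                   ∎)
      where open ≡-Reasoning

  module Routing (S : Subset N) {r : ℕ} (r<k : r < k) (class-free : ∀ v → toℕ v % k ≡ r → v ∉ S) where

    Free : ℕ → Set
    Free y = ∀ v → toℕ v ≡ y → v ∉ S

    _⇝_ : ℕ → ℕ → Set
    x ⇝ y = ∀ {u v} → toℕ u ≡ x → toℕ v ≡ y → Reach Tₜ S u v

    ⇝-refl : ∀ {x} → x ⇝ x
    ⇝-refl u≡x v≡x = subst (Reach Tₜ S _) (toℕ-injective (trans u≡x (sym v≡x))) here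

    ⇝-arc : ∀ {x y} → Arc x y → Free y → x ⇝ y
    ⇝-arc a free-y {v = v} refl refl = step (dec-true (arc? _ _) a) (free-y v refl) here

    ⇝-trans : ∀ {x y z} → y < N → x ⇝ y → y ⇝ z → x ⇝ z
    ⇝-trans y<N p q u≡x w≡z = reach-trans (p u≡x (toℕ-fromℕ< y<N)) (q (toℕ-fromℕ< y<N) w≡z)

    in-class-free : ∀ {x} → x % k ≡ r → Free x
    in-class-free x%k≡r v refl = class-free v x%k≡r

    r%k≡r : r % k ≡ r
    r%k≡r = m<n⇒m%n≡m r<k

    +k-free : ∀ {x} → x % k ≡ r → Free (x + k)
    +k-free {x} x%k≡r = in-class-free (trans ([m+n]%n≡m%n x k) x%k≡r)

    hub⇝class : ∀ q → q * k + r < N → r ⇝ (q * k + r)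
    hub⇝class zero    _  = ⇝-refl
    hub⇝class (suc q) lt =
      ⇝-trans prev<N (hub⇝class q prev<N) (subst ((q * k + r) ⇝_) (sym next≡prev+k) (⇝-arc forward (+k-free prev%k)))
      where
      next≡prev+k : k + q * k + r ≡ q * k + r + k
      next≡prev+k = trans (+-assoc k (q * k) r) (+-comm k (q * k + r))
      prev<N : q * k + r < N
      prev<N = <-trans (subst (q * k + r <_) (sym next≡prev+k) (m<m+n _ z<s)) lt
      prev%k : (q * k + r) % k ≡ r
      prev%k = trans (cong (_% k) (+-comm (q * k) r)) (trans ([m+kn]%n≡m%n r q k) r%k≡r)
      forward : Arc (q * k + r) (q * k + r + k)
      forward = inj₁ (m<m+n _ z<s , inj₁ refl)

    hub⇝residue : ∀ {x} → x < N → x % k ≡ r → r ⇝ x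
    hub⇝residue {x} x<N x%k≡r = subst (r ⇝_) (sym x≡) (hub⇝class (x / k) (subst (_< N) x≡ x<N))
      where
      x≡ : x ≡ (x / k) * k + r
      x≡ = trans (m≡m%n+[m/n]*n x k) (trans (cong (_+ (x / k) * k) x%k≡r) (+-comm r _))

    residue-in-window : ∀ y → ∃ λ c → y ≤ c × c < y + k × c % k ≡ r
    residue-in-window zero = r , z≤n , r<k , r%k≡r
    residue-in-window (suc y) with residue-in-window y
    ... | c , y≤c , c<y+k , c%k≡r with y ≟ c
    ...   | no y≢c  = c , ≤∧≢⇒< y≤c y≢c , m<n⇒m<1+n c<y+k , c%k≡r
    ...   | yes refl = y + k , m<m+n y z<s , n<1+n _ , trans ([m+n]%n≡m%n y k) c%k≡r

    r<N : r < N
    r<N = <-trans (<-≤-trans r<k k≤2k) 2k<N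

    r<hi : r < hi
    r<hi = <-≤-trans (<-≤-trans r<k k≤2k) 2k≤hi

    r+k<2k : r + k < 2k
    r+k<2k = +-monoˡ-< k r<k

    r+k⇝hub : (r + k) ⇝ r
    r+k⇝hub = ⇝-trans r+2k<N (⇝-arc (inj₁ (m<m+n _ z<s , inj₁ refl)) (+k-free (trans ([m+n]%n≡m%n r k) r%k≡r)))
                              (⇝-arc (inj₂ (r<r+2k , ¬forward)) (in-class-free r%k≡r))
      where
      r+2k<N : r + k + k < N
      r+2k<N = subst (_< N) (sym (+-assoc r k k)) (+-monoˡ-< 2k r<hi)
      r<r+2k : r < r + k + k
      r<r+2k = ≤-<-trans (m≤m+n r k) (m<m+n _ z<s)
      ¬forward : ¬ Forward r (r + k + k)
      ¬forward (inj₁ eq)               = <-irrefl (sym eq) (m<m+n _ z<s)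
      ¬forward (inj₂ (_ , inj₁ lt))    = <⇒≱ lt (+-monoˡ-≤ k (m≤n+m k r))
      ¬forward (inj₂ (_ , inj₂ hi≤r))  = <⇒≱ r<hi hi≤r

    r+k<N : r + k < N
    r+k<N = <-trans r+k<2k 2k<N

    ⇝hub : ∀ x → x ⇝ r
    ⇝hub x with 2k ≤? x
    ... | yes 2k≤x = ⇝-arc (inj₂ (<-≤-trans r<2k 2k≤x , ¬forward)) (in-class-free r%k≡r)
      where
      r<2k : r < 2k
      r<2k = <-≤-trans r<k k≤2k
      ¬forward : ¬ Forward r x
      ¬forward (inj₁ refl)              = <⇒≱ r+k<2k 2k≤x
      ¬forward (inj₂ (_ , inj₁ x<2k))   = <⇒≱ x<2k 2k≤x
      ¬forward (inj₂ (_ , inj₂ hi≤r))   = <⇒≱ r<hi hi≤r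
    ... | no 2k≰x with <-cmp x r
    ...   | tri< x<r _ _ = ⇝-trans r+k<N (⇝-arc forward (+k-free r%k≡r)) r+k⇝hub
      where
      forward : Arc x (r + k)
      forward = inj₁ (<-≤-trans x<r (m≤m+n r k) , inj₂ (+-monoˡ-≤ k (<⇒≤ x<r) , inj₁ r+k<2k))
    ...   | tri≈ _ refl _ = ⇝-refl
    ...   | tri> _ _ r<x with <-cmp x (r + k)
    ...     | tri< x<r+k _ _ = ⇝-arc (short-backward r<x x<r+k) (in-class-free r%k≡r)
    ...     | tri≈ _ refl _  = r+k⇝hub
    ...     | tri> _ _ r+k<x = ⇝-trans r+k<N (⇝-arc (short-backward r+k<x x<r+2k) (+k-free r%k≡r)) r+k⇝hub
      where
      x<r+2k : x < r + k + k
      x<r+2k = <-≤-trans (≰⇒> 2k≰x) (+-monoˡ-≤ k (m≤n+m k r))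

    hub⇝ : ∀ y → y < N → Free y → r ⇝ y
    hub⇝ y y<N free-y with y + k ≤? N | residue-in-window y
    ... | yes y+k≤N | c , y≤c , c<y+k , c%k≡r with y ≟ c
    ...   | yes refl = hub⇝residue y<N c%k≡r
    ...   | no y≢c   = ⇝-trans c<N (hub⇝residue c<N c%k≡r) (⇝-arc (short-backward (≤∧≢⇒< y≤c y≢c) c<y+k) free-y)
      where
      c<N : c < N
      c<N = <-≤-trans c<y+k y+k≤N
    hub⇝ y y<N free-y | no y+k≰N | _ with residue-in-window hi
    ... | c , hi≤c , c<hi+k , c%k≡r with c + k ≤? y
    ...   | yes c+k≤y = ⇝-trans c<N (hub⇝residue c<N c%k≡r) (⇝-arc forward free-y)
      where
      c<N : c < N
      c<N = <-trans c<hi+k (+-monoʳ-< hi (m<m+n k z<s))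
      forward : Arc c y
      forward = inj₁ (<-≤-trans (m<m+n c z<s) c+k≤y , inj₂ (c+k≤y , inj₂ hi≤c))
    ...   | no c+k≰y = ⇝-trans c+k<N (hub⇝residue c+k<N (trans ([m+n]%n≡m%n c k) c%k≡r))
                                  (⇝-arc (short-backward (≰⇒> c+k≰y) c+k<y+k) free-y)
      where
      c+k<N : c + k < N
      c+k<N = subst (c + k <_) (+-assoc hi k k) (+-monoˡ-< k c<hi+k)
      c+k<y+k : c + k < y + k
      c+k<y+k = <-trans c+k<N (≰⇒> y+k≰N)

  strongly-connected : StronglyConnected k Tₜ
  strongly-connected = k+1≤N , reach
    where
    k+1≤N : k + 1 ≤ N
    k+1≤N = ≤-trans (+-monoʳ-≤ k (s≤s z≤n)) (<⇒≤ 2k<N)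
    reach : ∀ u v (S : Subset N) → u ∉ S → v ∉ S → ∣ S ∣ ≤ k-1 → Reach Tₜ S u v
    reach u v S _ v∉S small with free-residue S small
    ... | r , r<k , class-free =
      reach-trans (⇝hub (toℕ u) refl (toℕ-fromℕ< r<N)) (hub⇝ (toℕ v) (toℕ<n v) free-v (toℕ-fromℕ< r<N) refl)
      where
      open Routing S r<k class-free
      free-v : Free (toℕ v)
      free-v w w≡v = subst (_∉ S) (sym (toℕ-injective w≡v)) v∉S

  gap : ℕ → Fin k-1 → ℕ
  gap lo = interval (suc lo) k-1

  ∈-gap : ∀ {lo z} → lo < z → z < lo + k → InImage (gap lo) z
  ∈-gap {lo} {z} lo<z z<lo+k = ∈-interval lo<z (subst (z <_) (+-suc lo k-1) z<lo+k)

  ∉-gap-left : ∀ {lo} → ¬ InImage (gap lo) lo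
  ∉-gap-left = ∉-interval (inj₁ ≤-refl)

  ∉-gap-beyond : ∀ {lo z} → lo + k ≤ z → ¬ InImage (gap lo) z
  ∉-gap-beyond {lo} {z} lo+k≤z = ∉-interval (inj₂ (subst (_≤ z) (+-suc lo k-1) lo+k≤z))

  ∉-gap-right : ∀ {lo} → ¬ InImage (gap lo) (lo + k)
  ∉-gap-right = ∉-gap-beyond ≤-refl

  outside-gap : ∀ {lo z} → ¬ InImage (gap lo) z → z < lo + k → z ≤ lo
  outside-gap {lo} {z} z∉ z<lo+k with z ≤? lo
  ... | yes z≤lo = z≤lo
  ... | no z≰lo  = contradiction (∈-gap (≰⇒> z≰lo) z<lo+k) z∉

  ¬Forward-in-block : ∀ {i j} → j < 2k ⊎ hi ≤ i → ¬ Forward i j → j < i + k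
  ¬Forward-in-block in-block ¬f = ≰⇒> λ i+k≤j → ¬f (inj₂ (i+k≤j , in-block))

  module Minimality {m} (f : Fin m → Fin N) (f-inj : Injective _≡_ _≡_ f)
                    (conn : StronglyConnected k (induced Tₜ f f-inj)) where

    F : Fin m → ℕ
    F = toℕ ∘ f

    F-inj : Injective _≡_ _≡_ F
    F-inj = f-inj ∘ toℕ-injective

    open Labelling {T = induced Tₜ f f-inj} F-inj

    Present : ℕ → Set
    Present = InImage F

    present? : ∀ z → Dec (Present z)
    present? = inImage? F

    present<N : ∀ {z} → Present z → z < N
    present<N (y , refl) = toℕ<n (f y)

    realised : {g : Fin j → ℕ} → (∀ l → Present (g l)) → ∀ {z} → InImage g z → Present z
    realised all (l , refl) = all l

    Out⊆ In⊆ : (Fin j → ℕ) → ℕ → Set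
    Out⊆ g a = ∀ z → Present z → Arc a z → InImage g z
    In⊆  g a = ∀ z → Present z → Arc z a → InImage g z

    ¬small-out : (g : Fin j → ℕ) → j ≤ k-1 → ∀ {a} → Present a → ¬ InImage g a → ¬ Out⊆ g a
    ¬small-out g j≤k-1 (_ , refl) a∉ out⊆ =
      out-labels-large {k = k-1} conn g j≤k-1 a∉ (λ y a → out⊆ (F y) (y , refl) (Arc⁻ a))

    ¬small-in : (g : Fin j → ℕ) → j ≤ k-1 → ∀ {a} → Present a → ¬ InImage g a → ¬ In⊆ g a
    ¬small-in g j≤k-1 (_ , refl) a∉ in⊆ =
      in-labels-large {k = k-1} conn g j≤k-1 a∉ (λ x a → in⊆ (F x) (x , refl) (Arc⁻ a))

    out-realised : (g : Fin k → ℕ) → ∀ {a} → Present a → ¬ InImage g a → Out⊆ g a → ∀ l → Present (g l)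
    out-realised g (_ , refl) a∉ out⊆ =
      out-labels-realised {k = k-1} conn g a∉ (λ y a → out⊆ (F y) (y , refl) (Arc⁻ a))

    in-realised : (g : Fin k → ℕ) → ∀ {a} → Present a → ¬ InImage g a → In⊆ g a → ∀ l → Present (g l)
    in-realised g (_ , refl) a∉ in⊆ =
      in-labels-realised {k = k-1} conn g a∉ (λ x a → in⊆ (F x) (x , refl) (Arc⁻ a))

    NoneBelow NoneAbove : ℕ → Set
    NoneBelow a = ∀ z → z < a → ¬ Present z
    NoneAbove b = ∀ z → b < z → ¬ Present z

    out-of-least : ∀ {a z} → NoneBelow a → Present z → Arc a z → Forward a z
    out-of-least _     _  (inj₁ (_ , f))   = f
    out-of-least below pz (inj₂ (z<a , _)) = contradiction pz (below _ z<a)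

    in-of-least : ∀ {a z} → NoneBelow a → Present z → Arc z a → a < z × ¬ Forward a z
    in-of-least below pz (inj₁ (z<a , _)) = contradiction pz (below _ z<a)
    in-of-least _     _  (inj₂ back)      = back

    out-of-greatest : ∀ {b z} → NoneAbove b → Present z → Arc b z → z < b × ¬ Forward z b
    out-of-greatest above pz (inj₁ (b<z , _)) = contradiction pz (above _ b<z)
    out-of-greatest _     _  (inj₂ back)      = back

    in-of-greatest : ∀ {b z} → NoneAbove b → Present z → Arc z b → Forward z b
    in-of-greatest _     _  (inj₁ (_ , f))   = f
    in-of-greatest above pz (inj₂ (b<z , _)) = contradiction pz (above _ b<z)

    least-not-hi : Present hi → ¬ NoneBelow hi
    least-not-hi p below = ¬small-in (gap hi) ≤-refl p ∉-gap-left in⊆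
      where
      in⊆ : In⊆ (gap hi) hi
      in⊆ z pz a with in-of-least below pz a
      ... | hi<z , ¬f = ∈-gap hi<z (¬Forward-in-block (inj₂ ≤-refl) ¬f)

    least-is-0 : ∀ {a} → Present a → NoneBelow a → a ≡ 0
    least-is-0 {zero}   _  _     = refl
    least-is-0 {suc a′} pa below with suc a′ ≟ hi
    ... | yes a≡hi = ⊥-elim (least-not-hi (subst Present a≡hi pa) (subst NoneBelow a≡hi below))
    ... | no  a≢hi = ⊥-elim (¬small-out (gap (a′ + k)) ≤-refl pa (∉-interval (inj₁ (s≤s (m<m+n a′ z<s)))) out⊆)
      where
      out⊆ : Out⊆ (gap (a′ + k)) (suc a′)
      out⊆ z pz a = ∈-gap (Forward⇒+k≤ forward) (bound forward)
        where
        forward : Forward (suc a′) z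
        forward = out-of-least below pz a
        bound : Forward (suc a′) z → z < a′ + k + k
        bound (inj₁ refl)             = subst (_≤ a′ + k + k) (+-comm (a′ + k) 2) (+-monoʳ-≤ (a′ + k) (s≤s (s≤s z≤n)))
        bound (inj₂ (_ , inj₁ z<2k))  = <-≤-trans z<2k (+-monoˡ-≤ k (m≤n+m k a′))
        bound (inj₂ (_ , inj₂ hi≤a))  = <-≤-trans (present<N pz)
          (subst (N ≤_) (sym (+-assoc a′ k k)) (+-monoˡ-≤ 2k (≤-pred (≤∧≢⇒< hi≤a (a≢hi ∘ sym)))))

    some-vertex : Fin m
    some-vertex = fromℕ< (<-≤-trans z<s (proj₁ conn))

    0-present : Present 0
    0-present with lowest present? (some-vertex , refl)
    ... | a , pa , below = subst Present (least-is-0 pa below) pa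

    lower-block-present : ∀ {z} → k ≤ z → z < 2k → Present z
    lower-block-present k≤z z<2k =
      realised (out-realised (interval k k) 0-present (∉-interval (inj₁ z<s)) out⊆) (∈-interval k≤z z<2k)
      where
      out⊆ : Out⊆ (interval k k) 0
      out⊆ _ _ (inj₁ (_ , inj₁ refl))                = ∈-interval ≤-refl (m<m+n k z<s)
      out⊆ _ _ (inj₁ (_ , inj₂ (k≤z′ , inj₁ z′<2k))) = ∈-interval k≤z′ z′<2k
      out⊆ _ _ (inj₁ (_ , inj₂ (_ , inj₂ ())))
      out⊆ _ _ (inj₂ (() , _))

    k-present : Present k
    k-present = lower-block-present ≤-refl (m<m+n k z<s)

    low-present : ∀ {z} → 0 < z → z < k → Present z
    low-present 0<z z<k =
      realised (out-realised (2k ∷ᶠ interval 1 k-1) k-present k∉ out⊆) (∈-∷-tail (∈-interval 0<z z<k))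
      where
      k∉ : ¬ InImage (2k ∷ᶠ interval 1 k-1) k
      k∉ = ∉-∷ (λ k≡2k → <-irrefl k≡2k (m<m+n k z<s)) (∉-interval (inj₂ ≤-refl))
      out⊆ : Out⊆ (2k ∷ᶠ interval 1 k-1) k
      out⊆ _       _ (inj₁ (_ , inj₁ refl))                 = ∈-∷-head
      out⊆ _       _ (inj₁ (_ , inj₂ (2k≤z′ , inj₁ z′<2k)))  = contradiction 2k≤z′ (<⇒≱ z′<2k)
      out⊆ _       _ (inj₁ (_ , inj₂ (_ , inj₂ hi≤k)))       = contradiction hi≤k (<⇒≱ (<-≤-trans (m<m+n k z<s) 2k≤hi))
      out⊆ zero    _ (inj₂ (_ , ¬f))                         = contradiction (inj₁ refl) ¬f
      out⊆ (suc _) _ (inj₂ (z′<k , _))                       = ∈-∷-tail (∈-interval (s≤s z≤n) z′<k)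

    greatest-not-in-lower-block : ∀ {c} → c < k → Present (c + k) → ¬ NoneAbove (c + k)
    greatest-not-in-lower-block {c} c<k pb above = ¬small-out (gap c) ≤-refl pb ∉-gap-right out⊆
      where
      out⊆ : Out⊆ (gap c) (c + k)
      out⊆ z pz a with out-of-greatest above pz a
      ... | z<b , ¬f = ∈-gap (+-cancelʳ-< k c z (¬Forward-in-block (inj₁ (+-monoˡ-< k c<k)) ¬f)) z<b

    greatest-not-in-middle : ∀ {c} → k ≤ c → c < hi → Present (c + k) → ¬ NoneAbove (c + k)
    greatest-not-in-middle {c} k≤c c<hi pb above =
      ¬small-in (interval c 1) (s≤s z≤n) pb (∉-interval (inj₂ (+-monoʳ-≤ c (s≤s z≤n)))) in⊆
      where
      in⊆ : In⊆ (interval c 1) (c + k)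
      in⊆ z pz a with in-of-greatest above pz a
      ... | inj₁ c+k≡z+k with refl ← +-cancelʳ-≡ k c z c+k≡z+k = ∈-interval ≤-refl (m<m+n c z<s)
      ... | inj₂ (_ , inj₁ c+k<2k)       = contradiction (+-monoˡ-≤ k k≤c) (<⇒≱ c+k<2k)
      ... | inj₂ (z+k≤c+k , inj₂ hi≤z)  = contradiction (≤-trans hi≤z (+-cancelʳ-≤ k z c z+k≤c+k)) (<⇒≱ c<hi)

    greatest-not-in-upper-block : ∀ {c} → hi ≤ c → c + k < N-1 → Present (c + k) → ¬ NoneAbove (c + k)
    greatest-not-in-upper-block {c} hi≤c c+k<N-1 pb above = ¬small-in (gap hi-1) ≤-refl pb b∉ in⊆
      where
      b∉ : ¬ InImage (gap hi-1) (c + k)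
      b∉ = ∉-interval (inj₂ (≤-trans (+-monoʳ-≤ hi (n≤1+n k-1)) (+-monoˡ-≤ k hi≤c)))
      hi≤ : ∀ {z} → Forward z (c + k) → hi ≤ z
      hi≤ (inj₁ c+k≡z+k)            = subst (hi ≤_) (+-cancelʳ-≡ k c _ c+k≡z+k) hi≤c
      hi≤ (inj₂ (_ , inj₁ c+k<2k))  = contradiction (≤-trans 2k≤hi (≤-trans hi≤c (m≤m+n c k))) (<⇒≱ c+k<2k)
      hi≤ (inj₂ (_ , inj₂ hi≤z))    = hi≤z
      in⊆ : In⊆ (gap hi-1) (c + k)
      in⊆ z pz a = ∈-interval (hi≤ forward) z<top-k
        where
        forward : Forward z (c + k)
        forward = in-of-greatest above pz a
        z<top-k : z < top-k
        z<top-k = +-cancelʳ-< k z top-k (≤-<-trans (Forward⇒+k≤ forward) (subst (c + k <_) (sym top-k+k≡N-1) c+k<N-1))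

    greatest-is-N-1 : ∀ {b} → Present b → NoneAbove b → b ≡ N-1
    greatest-is-N-1 {b} pb above with b ≟ N-1
    ... | yes b≡N-1 = b≡N-1
    ... | no  b≢N-1 = ⊥-elim (excluded (subst Present b≡c+k pb) (subst NoneAbove b≡c+k above))
      where
      k≤b : k ≤ b
      k≤b = ≮⇒≥ λ b<k → above k b<k k-present
      c : ℕ
      c = b ∸ k
      b≡c+k : b ≡ c + k
      b≡c+k = sym (m∸n+n≡m k≤b)
      b<N-1 : b < N-1
      b<N-1 = ≤∧≢⇒< (≤-pred (subst (b <_) N≡1+N-1 (present<N pb))) b≢N-1
      excluded : Present (c + k) → ¬ NoneAbove (c + k)
      excluded with c <? k | c <? hi
      ... | yes c<k | _        = greatest-not-in-lower-block c<k
      ... | no  c≮k | yes c<hi = greatest-not-in-middle (≮⇒≥ c≮k) c<hi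
      ... | no  _   | no  c≮hi = greatest-not-in-upper-block (≮⇒≥ c≮hi) (subst (_< N-1) b≡c+k b<N-1)

    N-1-present : Present N-1
    N-1-present with highest present? N-1 (λ {z} pz → ≤-pred (subst (z <_) N≡1+N-1 (present<N pz))) 0-present
    ... | b , pb , above = subst Present (greatest-is-N-1 pb above) pb

    upper-block-present : ∀ {z} → hi ≤ z → z < hi + k → Present z
    upper-block-present hi≤z z<hi+k =
      realised (in-realised (interval hi k) N-1-present N-1∉ in⊆) (∈-interval hi≤z z<hi+k)
      where
      N-1∉ : ¬ InImage (interval hi k) N-1
      N-1∉ = ∉-interval (inj₂ (+-monoʳ-≤ hi (m≤n+m k k-1)))
      hi≤ : ∀ {z} → Forward z N-1 → hi ≤ z
      hi≤ (inj₁ N-1≡z+k)           = subst (hi ≤_) (+-cancelʳ-≡ k top-k _ (trans top-k+k≡N-1 N-1≡z+k)) (m≤m+n hi k-1)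
      hi≤ (inj₂ (_ , inj₁ N-1<2k)) = contradiction (≤-trans 2k≤hi (m≤m+n hi (k-1 + k))) (<⇒≱ N-1<2k)
      hi≤ (inj₂ (_ , inj₂ hi≤z))   = hi≤z
      in⊆ : In⊆ (interval hi k) N-1
      in⊆ z _  (inj₁ (_ , forward)) = ∈-interval (hi≤ forward)
        (≤-<-trans (+-cancelʳ-≤ k z top-k (subst (z + k ≤_) (sym top-k+k≡N-1) (Forward⇒+k≤ forward))) (+-monoʳ-< hi (n<1+n k-1)))
      in⊆ z pz (inj₂ (N-1<z , _))   = contradiction (subst (z <_) N≡1+N-1 (present<N pz)) (<⇒≱ (s≤s N-1<z))

    top-k-present : Present top-k
    top-k-present = upper-block-present (m≤m+n hi k-1) (+-monoʳ-< hi (n<1+n k-1))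

    top-block-present : ∀ {z} → top-k < z → z < top-k + k → Present z
    top-block-present top-k<z z<top-k+k =
      realised (in-realised (hi-1 ∷ᶠ gap top-k) top-k-present top-k∉ in⊆) (∈-∷-tail (∈-gap top-k<z z<top-k+k))
      where
      hi-1<top-k : hi-1 < top-k
      hi-1<top-k = m≤m+n hi k-1
      top-k∉ : ¬ InImage (hi-1 ∷ᶠ gap top-k) top-k
      top-k∉ = ∉-∷ (λ e → <-irrefl (sym e) hi-1<top-k) ∉-gap-left
      in⊆ : In⊆ (hi-1 ∷ᶠ gap top-k) top-k
      in⊆ z _ (inj₁ (_ , inj₁ top-k≡z+k)) =
        subst (InImage _) (+-cancelʳ-≡ k hi-1 z (trans hi-1+k≡top-k top-k≡z+k)) ∈-∷-head
      in⊆ z _ (inj₁ (_ , inj₂ (_ , inj₁ top-k<2k))) = contradiction (≤-trans 2k≤hi (m≤m+n hi k-1)) (<⇒≱ top-k<2k)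
      in⊆ z _ (inj₁ (_ , inj₂ (z+k≤top-k , inj₂ hi≤z))) =
        contradiction (+-cancelʳ-≤ k z hi-1 (subst (z + k ≤_) (sym hi-1+k≡top-k) z+k≤top-k)) (<⇒≱ hi≤z)
      in⊆ z _ (inj₂ (top-k<z′ , ¬f)) = ∈-∷-tail (∈-gap top-k<z′ (¬Forward-in-block (inj₂ (m≤m+n hi k-1)) ¬f))

    middle-present : ∀ {c} → k ≤ c → c + k < hi → Present (c + k)
    middle-present {c} k≤c c+k<hi with present? (c + k) | 0-present | N-1-present
    ... | yes present | _ | _ = present
    -- Out-arcs from {x ≤ c} can only reach the gap (c, c + k) or the missing vertex c + k.
    ... | no  absent  | i₀ , Fi₀≡0 | iₙ , Fiₙ≡N-1 =
      ⊥-elim (<⇒≱ c<N-1 (subst (_≤ c) Fiₙ≡N-1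
        (closed-propagates {k} conn (∣labelled∣≤ (gap c)) closed (avoids Fi₀≡0 0∉gap) (avoids Fiₙ≡N-1 N-1∉gap)
                           (subst (_≤ c) (sym Fi₀≡0) z≤n))))
      where
      c<N-1 : c < N-1
      c<N-1 = <-≤-trans (≤-<-trans (m≤m+n c k) c+k<hi) (m≤m+n hi (k-1 + k))
      0∉gap : ¬ InImage (gap c) 0
      0∉gap = ∉-interval (inj₁ z<s)
      N-1∉gap : ¬ InImage (gap c) N-1
      N-1∉gap = ∉-gap-beyond (≤-trans (<⇒≤ c+k<hi) (m≤m+n hi (k-1 + k)))
      avoids : ∀ {i z} → F i ≡ z → ¬ InImage (gap c) z → i ∉ labelled (gap c)
      avoids refl = ∉-labelled⁺ (gap c)
      below-c+k : ∀ {x y} → F x ≤ c → Arc (F x) (F y) → F y < c + k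
      below-c+k Fx≤c (inj₂ (Fy<Fx , _))                = <-≤-trans Fy<Fx (≤-trans Fx≤c (m≤m+n c k))
      below-c+k {y = y} Fx≤c (inj₁ (_ , inj₁ Fy≡Fx+k)) =
        ≤∧≢⇒< (subst (_≤ c + k) (sym Fy≡Fx+k) (+-monoˡ-≤ k Fx≤c)) (λ Fy≡c+k → absent (y , Fy≡c+k))
      below-c+k Fx≤c (inj₁ (_ , inj₂ (_ , inj₁ Fy<2k))) = <-≤-trans Fy<2k (+-monoˡ-≤ k k≤c)
      below-c+k Fx≤c (inj₁ (_ , inj₂ (_ , inj₂ hi≤Fx))) =
        contradiction (≤-trans hi≤Fx Fx≤c) (<⇒≱ (≤-<-trans (m≤m+n c k) c+k<hi))
      closed : Closed (induced Tₜ f f-inj) (labelled (gap c)) (λ x → F x ≤ c)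
      closed _ Fx≤c a y∉ = outside-gap (y∉ ∘ ∈-labelled⁺ (gap c)) (below-c+k Fx≤c (Arc⁻ a))

    all-present : ∀ z → z < N → Present z
    all-present zero _ = 0-present
    all-present z@(suc _) z<N with z <? k | z <? 2k | z <? hi | z <? hi + k | z <? N-1
    ... | yes z<k | _        | _        | _          | _         = low-present z<s z<k
    ... | no  z≮k | yes z<2k | _        | _          | _         = lower-block-present (≮⇒≥ z≮k) z<2k
    ... | _       | no  z≮2k | yes z<hi | _          | _         =
      subst Present (m∸n+n≡m k≤z)
        (middle-present (m+n≤o⇒m≤o∸n k (≮⇒≥ z≮2k)) (subst (_< hi) (sym (m∸n+n≡m k≤z)) z<hi))
      where
      k≤z : k ≤ z
      k≤z = ≤-trans k≤2k (≮⇒≥ z≮2k)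
    ... | _       | _        | no  z≮hi | yes z<hi+k | _         = upper-block-present (≮⇒≥ z≮hi) z<hi+k
    ... | _       | _        | _        | no  z≮hi+k | yes z<N-1 =
      top-block-present (subst (_≤ z) (+-suc hi k-1) (≮⇒≥ z≮hi+k)) (subst (z <_) (sym top-k+k≡N-1) z<N-1)
    ... | _       | _        | _        | _          | no  z≮N-1 =
      subst Present (≤-antisym (≮⇒≥ z≮N-1) (≤-pred (subst (z <_) N≡1+N-1 z<N))) N-1-present

    N≤m : N ≤ m
    N≤m = injective⇒≤ index-inj
      where
      index : Fin N → Fin m
      index x = proj₁ (all-present (toℕ x) (toℕ<n x))
      index-inj : Injective _≡_ _≡_ index
      index-inj {x} {y} eq = toℕ-injective (begin
        toℕ x         ≡⟨ proj₂ (all-present (toℕ x) (toℕ<n x)) ⟨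
        F (index x)   ≡⟨ cong F eq ⟩
        F (index y)   ≡⟨ proj₂ (all-present (toℕ y) (toℕ<n y)) ⟩
        toℕ y         ∎)
        where open ≡-Reasoning

  minimally-strongly-connected : MinimallyStronglyConnected k Tₜ
  minimally-strongly-connected =
    strongly-connected , λ f f-inj m<N conn → <⇒≱ m<N (Minimality.N≤m f f-inj conn)

corollary1p3 : (k : ℕ) → 2 ≤ k →
    Σ (ℕ → Tournament) λ T →
      (∀ i → MinimallyStronglyConnected k (T i)) ×
      (∀ i j → i ≢ j → ¬ Isomorphic (T i) (T j))
corollary1p3 (suc (suc k-2)) (s≤s (s≤s z≤n)) =
  Construction.Tₜ k-2 , Construction.minimally-strongly-connected k-2 , non-isomorphic
  where
  non-isomorphic : ∀ s t → s ≢ t → ¬ Isomorphic (Construction.Tₜ k-2 s) (Construction.Tₜ k-2 t)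
  non-isomorphic s t s≢t (φ , _) = s≢t (+-cancelˡ-≡ 2k s t (+-cancelʳ-≡ 2k (2k + s) (2k + t) (↔⇒≡ φ)))
    where open Construction k-2 s using (2k)
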